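{- Let $m\ge 3$, let $P$ be the Apéry poset of some numerical semigroup of multiplicity $m$, and let $e-1$ be the number of minimal elements of $P$. Suppose that for each maximal element $f$ of $P$ there is a sequence of Wilf moves winning the Wilf game of $(P,f)$. Then every numerical semigroup $S$ of multiplicity $m$ with Apéry poset $P$ satisfies $\operatorname c(S)\le \operatorname e(S)\operatorname n(S)$; equivalently, for every such $S$ with Kunz coordinates $(x_1,\dots,x_{m-1})$ and every $f\in\{1,\dots,m-1\}$ with $mx_i+i\le mx_f+f$ for all $i$, one has $mx_f+f-m+1\le e\,(mx_f+f-m-(x_1+\cdots+x_{m-1})+1)$.
   Context: A numerical semigroup is a subset $S\subseteq\mathbb Z_{\ge 0}$ containing $0$, closed under addition, with finite complement. $\operatorname m(S)=\min(S\setminus\{0\})$; $\operatorname e(S)$ is the number of positive elements of $S$ not a sum of two positive elements of $S$; $\operatorname c(S)$ is the least $c$ with $c+\mathbb Z_{\ge0}\subseteq S$; $\operatorname n(S)=|\{s\in S:s<\operatorname c(S)\}|$. For multiplicity $m$, $\mathrm{Ap}(S;m)=\{0,a_1,\dots,a_{m-1}\}$ with $a_i=\min\{s\in S: s\equiv i\bmod m\}=k_im+i$; $(k_1,\dots,k_{m-1})$ are the Kunz coordinates. The Apéry poset is $(\mathbb Z/(m)\setminus\{0\},\preceq)$ with $i\preceq j$ iff $a_j-a_i\in S$; its elements are identified with the integers $1,\dots,m-1$. (For a semigroup with Apéry poset $P$, $\operatorname e(S)-1$ equals the number of minimal elements of $P$.) Wilf game of $(P,f)$, for $f$ a maximal element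 of $P$: it is played on formal expressions $\sum_{i=1}^{m-1}a_ix_i$ with $a_i\in\mathbb Z_{\ge0}$. A Wilf move replaces $x_i+x_j$ by $x_k$ in the current expression (the summands $x_i,x_j$ must be present), where $i,k\in P$, $i\prec k$, and $j=k-i$ in $\mathbb Z/(m)$. The score of a move $x_i+x_j\to x_k$ is the sum of: (i) $-1$ if $i>f$, $-1$ if $j>f$, and $+1$ if $k>f$; (ii) $+1$ if $k<i$ (equivalently $k<j$); (iii) $+2$ if the move is not one of the first $m-e$ moves performed. A sequence of at least $m-e$ successive Wilf moves starting from $e x_1+\cdots+e x_{m-1}$ wins the game if $(m-1-f)$ plus the sum of the scores of the moves is non-negative. -}

module Defs where

open import Data.Nat using (ℕ; zero; suc; _+_; _*_; _∸_; _≤_; _<_; _<ᵇ_; _≤ᵇ_; _≡ᵇ_)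
open import Data.Bool using (Bool; true; false; if_then_else_; _∧_)
open import Data.Integer using (ℤ; +_; -[1+_]) renaming (_+_ to _+ℤ_; _-_ to _-ℤ_; _≤_ to _≤ℤ_)
open import Data.List using (List; []; _∷_; length)
open import Data.List.Membership.Propositional using (_∈_)
open import Data.List.Relation.Unary.Unique.Propositional using (Unique)
open import Data.Product using (Σ; ∃; ∃-syntax; _×_; _,_)
open import Relation.Binary.PropositionalEquality using (_≡_; _≢_)
open import Relation.Nullary using (¬_)

record NumericalSemigroup : Set where
  field
    mem      : ℕ → Bool
    zero∈    : mem 0 ≡ true
    closed   : ∀ a b → mem a ≡ true → mem b ≡ true → mem (a + b) ≡ true
    cofinite : ∃[ c ] (∀ k → mem (c + k) ≡ true)

open NumericalSemigroup public

_∈S_ : ℕ → NumericalSemigroup → Set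
s ∈S S = mem S s ≡ true

IsMultiplicity : NumericalSemigroup → ℕ → Set
IsMultiplicity S m = (0 < m) × (m ∈S S) × (∀ s → 0 < s → s ∈S S → m ≤ s)

IsConductor : NumericalSemigroup → ℕ → Set
IsConductor S c =
  (∀ k → (c + k) ∈S S) × (∀ c' → (∀ k → (c' + k) ∈S S) → c ≤ c')

HasCard : (ℕ → Set) → ℕ → Set
HasCard A k = Σ (List ℕ) λ L →
  Unique L × (∀ x → (x ∈ L → A x) × (A x → x ∈ L)) × (length L ≡ k)

-- elements of S smaller than c (counted by n(S))
SmallElt : NumericalSemigroup → ℕ → ℕ → Set
SmallElt S c s = (s ∈S S) × (s < c)

-- minimal generators (counted by e(S))
IsMinGen : NumericalSemigroup → ℕ → Set
IsMinGen S s = (0 < s) × (s ∈S S) ×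
  ¬ (∃[ a ] ∃[ b ] ((0 < a) × (0 < b) × (a ∈S S) × (b ∈S S) × (a + b ≡ s)))

-- Apéry set and Apéry poset (elements identified with 1,…,m-1)

InRange : ℕ → ℕ → Set
InRange m i = (1 ≤ i) × (i < m)

IsAperyElt : NumericalSemigroup → ℕ → ℕ → ℕ → Set
IsAperyElt S m i a =
  (a ∈S S) × (∃[ q ] (a ≡ q * m + i)) ×
  (∀ s → s ∈S S → ∃[ q ] (s ≡ q * m + i) → a ≤ s)

AperyLeq : NumericalSemigroup → ℕ → ℕ → ℕ → Set
AperyLeq S m i j = ∃[ ai ] ∃[ aj ]
  (IsAperyElt S m i ai × IsAperyElt S m j aj × (ai ≤ aj) × ((aj ∸ ai) ∈S S))

SameAperyPoset : NumericalSemigroup → NumericalSemigroup → ℕ → Set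
SameAperyPoset S T m = ∀ i j → InRange m i → InRange m j →
  (AperyLeq S m i j → AperyLeq T m i j) × (AperyLeq T m i j → AperyLeq S m i j)

IsMinimalIn : (ℕ → ℕ → Set) → ℕ → ℕ → Set
IsMinimalIn P m i = InRange m i × (∀ j → InRange m j → P j i → j ≡ i)

IsMaximalIn : (ℕ → ℕ → Set) → ℕ → ℕ → Set
IsMaximalIn P m f = InRange m f × (∀ k → InRange m k → P f k → k ≡ f)

-- formal expression Σ a_i x_i : coefficient of x_i
Expr : Set
Expr = ℕ → ℕ

startExpr : ℕ → ℕ → Expr
startExpr m e n = if (1 ≤ᵇ n) ∧ (n <ᵇ m) then e else 0

removeOne : Expr → ℕ → Expr
removeOne a i n = if n ≡ᵇ i then a n ∸ 1 else a n

addOne : Expr → ℕ → Expr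
addOne a k n = if n ≡ᵇ k then suc (a n) else a n

-- j = k - i in ℤ/(m), represented in {1,…,m-1} (for i ≠ k in {1,…,m-1})
wilfJ : ℕ → ℕ → ℕ → ℕ
wilfJ m i k = if i ≤ᵇ k then k ∸ i else (k + m) ∸ i

applyMove : ℕ → Expr → ℕ → ℕ → Expr
applyMove m a i k = addOne (removeOne (removeOne a i) (wilfJ m i k)) k

-- a sequence of successive Wilf moves (each move given by (i , k)) in P,
-- legal from the given expression
data Play (P : ℕ → ℕ → Set) (m : ℕ) : Expr → List (ℕ × ℕ) → Set where
  done : ∀ {a} → Play P m a []
  move : ∀ {a i k ms} →
         InRange m i → InRange m k → P i k → i ≢ k →
         1 ≤ a i →                                   -- x_i present
         1 ≤ removeOne a i (wilfJ m i k) →           -- then x_j present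
         Play P m (applyMove m a i k) ms →
         Play P m a ((i , k) ∷ ms)

ind : Bool → ℤ → ℤ
ind b z = if b then z else + 0

-- score of the move x_i + x_j → x_k performed as move number t (0-based)
moveScore : ℕ → ℕ → ℕ → ℕ → ℕ → ℕ → ℤ
moveScore m e f t i k =
  ind (f <ᵇ i) -[1+ 0 ] +ℤ ind (f <ᵇ wilfJ m i k) -[1+ 0 ] +ℤ ind (f <ᵇ k) (+ 1)
  +ℤ ind (k <ᵇ i) (+ 1)
  +ℤ ind ((m ∸ e) ≤ᵇ t) (+ 2)

scoreFrom : ℕ → ℕ → ℕ → ℕ → List (ℕ × ℕ) → ℤ
scoreFrom m e f t [] = + 0
scoreFrom m e f t ((i , k) ∷ ms) = moveScore m e f t i k +ℤ scoreFrom m e f (suc t) ms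

WinsWilfGame : (ℕ → ℕ → Set) → ℕ → ℕ → ℕ → List (ℕ × ℕ) → Set
WinsWilfGame P m e f ms =
  Play P m (startExpr m e) ms × ((m ∸ e) ≤ length ms) ×
  (+ 0 ≤ℤ ((+ (m ∸ 1) -ℤ + f) +ℤ scoreFrom m e f 0 ms))

module Submission where

-- Let S have multiplicity m and Kunz coordinates x_1,…,x_{m-1}: the Apéry element
-- ap i = x_i·m + i is the least element of S congruent to i.  Choose f with ap f largest.
-- Counting gives c ≥ C := ap f − m + 1 (the Frobenius number ap f − m is a gap),
-- c ≤ n + X with X = Σ x_i (the gaps are the q·m + i with q < x_i), and e ≥ E := 1 + #min
-- (m and the Apéry elements of the minimal elements are distinct minimal generators).
-- So it suffices that E·X ≤ (E − 1)·C, proved by a potential argument: weight x_n by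
-- φ_n = x_f − x_n − [f < n] ≥ 0.  By the Kunz inequality x_i + x_j + [k < i] ≤ x_k
-- (i ≼ k, j = k − i), every Wilf move x_i + x_j → x_k lowers the value of the expression at
-- x = φ by at least x_f plus the move's score without bonus; compare with the starting
-- value E·Σ φ_n and the winning condition.

open import Defs
open import Data.Bool using (Bool; true; false; T)
open import Data.Empty using (⊥)
open import Data.List using (List; []; _∷_; length; _++_; map; upTo)
open import Data.List.Membership.Propositional using (_∈_)
open import Data.List.Relation.Unary.Any using (here; there)
open import Data.List.Relation.Unary.All as All using ()
open import Data.List.Relation.Unary.AllPairs using (_∷_)
open import Data.List.Relation.Unary.Unique.Propositional using (Unique)
open import Data.Nat as ℕ using (ℕ)
open import Data.Product using (Σ; ∃-syntax; _×_; _,_; proj₁; proj₂)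
open import Data.Sum using (_⊎_; inj₁; inj₂)
open import Function using (_∘_; _∘′_)
open import Relation.Binary.PropositionalEquality
open import Relation.Nullary using (¬_; yes; no; contradiction)

module NaturalFacts where
  open import Data.Nat
  open import Data.Nat.DivMod
  open import Data.Nat.Properties
  open import Data.Nat.Tactic.RingSolver using (solve-∀)

  bit : Bool → ℕ
  bit true  = 1
  bit false = 0

  true-if : ∀ {b} → T b → b ≡ true
  true-if {true} _ = refl

  false-if : ∀ {b} → ¬ T b → b ≡ false
  false-if {false} _ = refl
  false-if {true} ¬t = contradiction _ ¬t

  residue : ∀ {m} .{{_ : NonZero m}} q {r} → r < m → (q * m + r) % m ≡ r
  residue {m} q {r} r<m = begin
    (q * m + r) % m ≡⟨ cong (_% m) (+-comm (q * m) r) ⟩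
    (r + q * m) % m ≡⟨ [m+kn]%n≡m%n r q m ⟩
    r % m           ≡⟨ m<n⇒m%n≡m r<m ⟩
    r               ∎
    where open ≡-Reasoning

  divmod-unique : ∀ {m} .{{_ : NonZero m}} q q' {r r'} → r < m → r' < m →
                  q * m + r ≡ q' * m + r' → r ≡ r' × q ≡ q'
  divmod-unique {m} q q' {r} {r'} r<m r'<m eq = r≡r' , q≡q'
    where
    r≡r' : r ≡ r'
    r≡r' = trans (sym (residue q r<m)) (trans (cong (_% m) eq) (residue q' r'<m))
    q≡q' : q ≡ q'
    q≡q' = *-cancelʳ-≡ q q' m (+-cancelʳ-≡ r (q * m) (q' * m) (trans eq (cong (q' * m +_) (sym r≡r'))))

  quotient-mono : ∀ {m} a b {r r'} → r' < m → a * m + r ≤ b * m + r' → a + bit (r' <ᵇ r) ≤ b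
  quotient-mono {m} a b {r} {r'} r'<m le with r' <? r
  ... | yes r'<r rewrite true-if (<⇒<ᵇ r'<r) = subst (_≤ b) (+-comm 1 a) (≰⇒> b≱a)
    where
    b≱a : ¬ b ≤ a
    b≱a b≤a = <⇒≱ (+-mono-≤-< (*-monoˡ-≤ m b≤a) r'<r) le
  ... | no r'≮r rewrite false-if (r'≮r ∘′ <ᵇ⇒< r' r) = subst (_≤ b) (sym (+-identityʳ a)) (≮⇒≥ b≮a)
    where
    open ≤-Reasoning
    b≮a : ¬ b < a
    b≮a b<a = <⇒≱ (begin-strict
      b * m + r' <⟨ +-monoʳ-< (b * m) r'<m ⟩
      b * m + m  ≡⟨ +-comm (b * m) m ⟩
      suc b * m  ≤⟨ *-monoˡ-≤ m b<a ⟩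
      a * m      ≤⟨ m≤m+n (a * m) r ⟩
      a * m + r  ∎) le

  Least : (ℕ → Bool) → Set
  Least p = Σ ℕ λ q → p q ≡ true × (∀ q' → p q' ≡ true → q ≤ q')

  least : (p : ℕ → Bool) → ∀ N → p N ≡ true → Least p
  least p zero    pN = 0 , pN , λ _ _ → z≤n
  least p (suc N) pN with p 0 in p0
  ... | true  = 0 , p0 , λ _ _ → z≤n
  ... | false with least (λ q → p (suc q)) N pN
  ...   | q , pq , minimal = suc q , pq , above
    where
    above : ∀ q' → p q' ≡ true → suc q ≤ q'
    above zero     p0' = contradiction (trans (sym p0) p0') λ ()
    above (suc q') pq' = s≤s (minimal q' pq')

  wilfJ-≤ : ∀ m {i k} → i ≤ k → wilfJ m i k ≡ k ∸ i
  wilfJ-≤ m i≤k rewrite true-if (≤⇒≤ᵇ i≤k) = refl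

  wilfJ-> : ∀ m {i k} → k < i → wilfJ m i k ≡ k + m ∸ i
  wilfJ-> m {i} {k} k<i rewrite false-if {i ≤ᵇ k} (<⇒≱ k<i ∘′ ≤ᵇ⇒≤ i k) = refl

  wilfJ-carry : ∀ {m i} k → i ≤ m → i + wilfJ m i k ≡ bit (k <ᵇ i) * m + k
  wilfJ-carry {m} {i} k i≤m with i ≤? k
  ... | yes i≤k rewrite wilfJ-≤ m i≤k | false-if {k <ᵇ i} (≤⇒≯ i≤k ∘′ <ᵇ⇒< k i) = m+[n∸m]≡n i≤k
  ... | no i≰k rewrite wilfJ-> m (≰⇒> i≰k) | true-if (<⇒<ᵇ (≰⇒> i≰k)) = begin
    i + (k + m ∸ i) ≡⟨ m+[n∸m]≡n (≤-trans i≤m (m≤n+m m k)) ⟩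
    k + m           ≡⟨ +-comm k m ⟩
    m + k           ≡⟨ cong (_+ k) (+-identityʳ m) ⟨
    m + 0 + k       ∎
    where open ≡-Reasoning

  wilfJ-< : ∀ {m i k} → i < m → k < m → wilfJ m i k < m
  wilfJ-< {m} {i} {k} i<m k<m with i ≤? k
  ... | yes i≤k rewrite wilfJ-≤ m i≤k = ≤-<-trans (m∸n≤m k i) k<m
  ... | no i≰k rewrite wilfJ-> m (≰⇒> i≰k) =
    +-cancelˡ-< i (k + m ∸ i) m (subst (_< i + m) (sym (m+[n∸m]≡n (≤-trans (<⇒≤ i<m) (m≤n+m m k))))
                                       (+-monoˡ-< m (≰⇒> i≰k)))

  wilfJ-range : ∀ {m i k} → InRange m i → InRange m k → i ≢ k → InRange m (wilfJ m i k)
  wilfJ-range {m} {i} {k} (_ , i<m) (_ , k<m) i≢k = positive , wilfJ-< i<m k<m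
    where
    positive : 1 ≤ wilfJ m i k
    positive with i ≤? k
    ... | yes i≤k rewrite wilfJ-≤ m i≤k = m<n⇒0<n∸m (≤∧≢⇒< i≤k i≢k)
    ... | no i≰k rewrite wilfJ-> m (≰⇒> i≰k) = m<n⇒0<n∸m (<-≤-trans i<m (m≤n+m m k))

  not-above : ∀ {R n} → InRange (suc R) n → (R <ᵇ n) ≡ false
  not-above {R} (_ , s≤s n≤R) = false-if (≤⇒≯ n≤R ∘′ <ᵇ⇒< R _)

  sumTo : ℕ → (ℕ → ℕ) → ℕ
  sumTo zero    g = 0
  sumTo (suc R) g = g (suc R) + sumTo R g

  sumTo-cong : ∀ R {g h} → (∀ n → 1 ≤ n → n ≤ R → g n ≡ h n) → sumTo R g ≡ sumTo R h
  sumTo-cong zero    eq = refl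
  sumTo-cong (suc R) eq = cong₂ _+_ (eq (suc R) (s≤s z≤n) ≤-refl) (sumTo-cong R λ n 1≤n n≤R → eq n 1≤n (m≤n⇒m≤1+n n≤R))

  sumTo-+ : ∀ R g h → sumTo R (λ n → g n + h n) ≡ sumTo R g + sumTo R h
  sumTo-+ zero    g h = refl
  sumTo-+ (suc R) g h = trans (cong (g (suc R) + h (suc R) +_) (sumTo-+ R g h)) (interchange (g (suc R)) _ _ _)
    where
    interchange : ∀ a b c d → (a + b) + (c + d) ≡ (a + c) + (b + d)
    interchange = solve-∀

  sumTo-* : ∀ R c g → sumTo R (λ n → c * g n) ≡ c * sumTo R g
  sumTo-* zero    c g = sym (*-zeroʳ c)
  sumTo-* (suc R) c g = trans (cong (c * g (suc R) +_) (sumTo-* R c g)) (sym (*-distribˡ-+ c (g (suc R)) _))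

  sumTo-const : ∀ R c → sumTo R (λ _ → c) ≡ R * c
  sumTo-const zero    c = refl
  sumTo-const (suc R) c = cong (c +_) (sumTo-const R c)

  sumTo-update : ∀ R {g h} p → 1 ≤ p → p ≤ R → (∀ n → n ≢ p → g n ≡ h n) →
                 sumTo R g + h p ≡ sumTo R h + g p
  sumTo-update zero    p 1≤p p≤0 _ = contradiction p≤0 (<⇒≱ 1≤p)
  sumTo-update (suc R) {g} {h} p 1≤p p≤R agree with m≤n⇒m<n∨m≡n p≤R
  ... | inj₂ refl = begin
    g p + sumTo R g + h p ≡⟨ cong (λ s → g p + s + h p) (sumTo-cong R λ n _ n≤R → agree n (<⇒≢ (s≤s n≤R))) ⟩
    g p + sumTo R h + h p ≡⟨ swap (g p) _ _ ⟩
    h p + sumTo R h + g p ∎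
    where
    open ≡-Reasoning
    swap : ∀ a b c → a + b + c ≡ c + b + a
    swap = solve-∀
  ... | inj₁ (s≤s p≤R') = begin
    g (suc R) + sumTo R g + h p   ≡⟨ +-assoc (g (suc R)) _ _ ⟩
    g (suc R) + (sumTo R g + h p) ≡⟨ cong₂ _+_ (agree (suc R) (λ e → <⇒≢ (s≤s p≤R') (sym e))) (sumTo-update R p 1≤p p≤R' agree) ⟩
    h (suc R) + (sumTo R h + g p) ≡⟨ +-assoc (h (suc R)) _ _ ⟨
    h (suc R) + sumTo R h + g p   ∎
    where open ≡-Reasoning

  count-above : ∀ f R → sumTo R (λ n → bit (f <ᵇ n)) ≡ R ∸ f
  count-above f zero    = sym (0∸n≡0 f)
  count-above f (suc R) with f ≤? R
  ... | yes f≤R rewrite true-if (<⇒<ᵇ (s≤s f≤R)) = trans (cong suc (count-above f R)) (sym (+-∸-assoc 1 f≤R))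
  ... | no f≰R rewrite false-if {f <ᵇ suc R} (f≰R ∘′ s≤s⁻¹ ∘′ <ᵇ⇒< f (suc R)) =
    trans (count-above f R) (trans (m≤n⇒m∸n≡0 (<⇒≤ (≰⇒> f≰R))) (sym (m≤n⇒m∸n≡0 (≰⇒> f≰R))))

  remove : ∀ {x : ℕ} (ys : List ℕ) → x ∈ ys → List ℕ
  remove (y ∷ ys) (here _)  = ys
  remove (y ∷ ys) (there p) = y ∷ remove ys p

  remove-length : ∀ {x : ℕ} (ys : List ℕ) (p : x ∈ ys) → length ys ≡ suc (length (remove ys p))
  remove-length (y ∷ ys) (here _)  = refl
  remove-length (y ∷ ys) (there p) = cong suc (remove-length ys p)

  remove-keeps : ∀ {x z : ℕ} (ys : List ℕ) (p : x ∈ ys) → z ∈ ys → z ≢ x → z ∈ remove ys p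
  remove-keeps (y ∷ ys) (here refl) (here refl) z≢x = contradiction refl z≢x
  remove-keeps (y ∷ ys) (here refl) (there q)   _   = q
  remove-keeps (y ∷ ys) (there p)   (here refl) _   = here refl
  remove-keeps (y ∷ ys) (there p)   (there q)   z≢x = there (remove-keeps ys p q z≢x)

  unique-⊆-length : ∀ (xs ys : List ℕ) → Unique xs → (∀ {z} → z ∈ xs → z ∈ ys) → length xs ≤ length ys
  unique-⊆-length []       ys _          _   = z≤n
  unique-⊆-length (x ∷ xs) ys (x∉ ∷ u) sub =
    subst (suc (length xs) ≤_) (sym (remove-length ys x∈ys))
      (s≤s (unique-⊆-length xs (remove ys x∈ys) u λ z∈xs →
        remove-keeps ys x∈ys (sub (there z∈xs)) λ z≡x → All.lookup x∉ z∈xs (sym z≡x)))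
    where
    x∈ys : x ∈ ys
    x∈ys = sub (here refl)

  range-step : ∀ {M n} → InRange (suc M) n → InRange M n ⊎ n ≡ M
  range-step (1≤n , s≤s n≤M) with m≤n⇒m<n∨m≡n n≤M
  ... | inj₁ n<M = inj₁ (1≤n , n<M)
  ... | inj₂ n≡M = inj₂ n≡M

  argmax : (g : ℕ → ℕ) (R : ℕ) → Σ ℕ λ f → InRange (suc (suc R)) f × (∀ n → InRange (suc (suc R)) n → g n ≤ g f)
  argmax g zero = 1 , (≤-refl , ≤-refl) , λ n n-range → ≤-reflexive (cong g (only-one n-range))
    where
    only-one : ∀ {n} → InRange 2 n → n ≡ 1
    only-one (1≤n , s≤s n≤1) = ≤-antisym n≤1 1≤n
  argmax g (suc R) with argmax g R
  ... | f , f-range , max with g f ≤? g (suc (suc R))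
  ...   | yes gf≤ = suc (suc R) , (s≤s z≤n , ≤-refl) , below
    where
    below : ∀ n → InRange (suc (suc (suc R))) n → g n ≤ g (suc (suc R))
    below n n-range with range-step n-range
    ... | inj₁ n-range′ = ≤-trans (max n n-range′) gf≤
    ... | inj₂ refl     = ≤-refl
  ...   | no gf≰ = f , (proj₁ f-range , m<n⇒m<1+n (proj₂ f-range)) , below
    where
    below : ∀ n → InRange (suc (suc (suc R))) n → g n ≤ g f
    below n n-range with range-step n-range
    ... | inj₁ n-range′ = max n n-range′
    ... | inj₂ refl     = <⇒≤ (≰⇒> gf≰)

module AperySet (m : ℕ) .{{_ : ℕ.NonZero m}} (S : NumericalSemigroup) (mult : IsMultiplicity S m) where
  open import Data.Nat
  open import Data.Nat.DivMod
  open import Data.Nat.Properties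
  open import Data.Nat.Tactic.RingSolver using (solve-∀)
  open import Data.List.Properties using (length-map; length-++; length-upTo; map-∘; map-id-local)
  open import Data.List.Membership.Propositional.Properties
    using (∈-++⁺ˡ; ∈-++⁺ʳ; ∈-map⁺; ∈-map⁻; ∈-upTo⁺; ∈-upTo⁻)
  import Data.List.Relation.Unary.Unique.Propositional.Properties as Unique
  open NaturalFacts

  m∈S : m ∈S S
  m∈S = proj₁ (proj₂ mult)

  multiple∈S : ∀ q → (q * m) ∈S S
  multiple∈S zero    = zero∈ S
  multiple∈S (suc q) = closed S m (q * m) m∈S (multiple∈S q)

  class-meets-S : ∀ r → (proj₁ (cofinite S) * m + r) ∈S S
  class-meets-S r = subst (_∈S S) (m+[n∸m]≡n c≤) (proj₂ (cofinite S) _)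
    where
    c : ℕ
    c = proj₁ (cofinite S)
    c≤ : c ≤ c * m + r
    c≤ = ≤-trans (m≤m*n c m) (m≤m+n (c * m) r)

  least-in-class : ∀ r → Least (λ q → mem S (q * m + r))
  least-in-class r = least (λ q → mem S (q * m + r)) (proj₁ (cofinite S)) (class-meets-S r)

  kunz : ℕ → ℕ
  kunz r = proj₁ (least-in-class r)

  ap : ℕ → ℕ
  ap r = kunz r * m + r

  ap∈S : ∀ r → ap r ∈S S
  ap∈S r = proj₁ (proj₂ (least-in-class r))

  kunz-least : ∀ r q → (q * m + r) ∈S S → kunz r ≤ q
  kunz-least r = proj₂ (proj₂ (least-in-class r))

  ap-split : ∀ r q → kunz r ≤ q → q * m + r ≡ ap r + (q ∸ kunz r) * m
  ap-split r q k≤q = begin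
    q * m + r                           ≡⟨ cong (λ x → x * m + r) (m+[n∸m]≡n k≤q) ⟨
    (kunz r + (q ∸ kunz r)) * m + r     ≡⟨ rearrange (kunz r) (q ∸ kunz r) m r ⟩
    kunz r * m + r + (q ∸ kunz r) * m   ∎
    where
    open ≡-Reasoning
    rearrange : ∀ a b m r → (a + b) * m + r ≡ a * m + r + b * m
    rearrange = solve-∀

  above-ap∈S : ∀ r q → kunz r ≤ q → (q * m + r) ∈S S
  above-ap∈S r q k≤q = subst (_∈S S) (sym (ap-split r q k≤q))
    (closed S (ap r) _ (ap∈S r) (multiple∈S (q ∸ kunz r)))

  div-mod : ∀ x → x ≡ x / m * m + x % m
  div-mod x = trans (m≡m%n+[m/n]*n x m) (+-comm (x % m) _)

  ap-decompose : ∀ s → s ∈S S → s ≡ ap (s % m) + (s / m ∸ kunz (s % m)) * m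
  ap-decompose s s∈S =
    trans (div-mod s) (ap-split (s % m) (s / m) (kunz-least (s % m) (s / m) (subst (_∈S S) (div-mod s) s∈S)))

  ap-least : ∀ s → s ∈S S → ap (s % m) ≤ s
  ap-least s s∈S = subst (ap (s % m) ≤_) (sym (ap-decompose s s∈S)) (m≤m+n _ _)

  ap-isApery : ∀ r → IsAperyElt S m r (ap r)
  ap-isApery r = ap∈S r , (kunz r , refl) , λ { s s∈S (q , refl) → +-monoˡ-≤ r (*-monoˡ-≤ m (kunz-least r q s∈S)) }

  ap-unique : ∀ r a → IsAperyElt S m r a → a ≡ ap r
  ap-unique r a (a∈S , (q , refl) , a-min) =
    ≤-antisym (a-min (ap r) (ap∈S r) (kunz r , refl)) (proj₂ (proj₂ (ap-isApery r)) a a∈S (q , refl))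

  ap-residue : ∀ r → r < m → ap r % m ≡ r
  ap-residue r = residue (kunz r)

  ap-injective : ∀ i j → InRange m i → InRange m j → ap i ≡ ap j → i ≡ j
  ap-injective i j (_ , i<m) (_ , j<m) eq = proj₁ (divmod-unique (kunz i) (kunz j) i<m j<m eq)

  -- Nonzero residues are not in S below m, so their Kunz coordinates are positive.
  kunz-positive : ∀ i → InRange m i → 1 ≤ kunz i
  kunz-positive i (1≤i , i<m) with kunz i in eq
  ... | suc _ = s≤s z≤n
  ... | zero  = contradiction (proj₂ (proj₂ mult) i 1≤i (subst (λ q → (q * m + i) ∈S S) eq (ap∈S i))) (<⇒≱ i<m)

  ≼-intro : ∀ i k d → d ∈S S → ap i + d ≡ ap k → AperyLeq S m i k
  ≼-intro i k d d∈S eq = ap i , ap k , ap-isApery i , ap-isApery k ,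
    subst (ap i ≤_) eq (m≤m+n (ap i) d) , subst (_∈S S) (sym (trans (cong (_∸ ap i) (sym eq)) (m+n∸m≡n (ap i) d))) d∈S

  ≼-elim : ∀ i k → AperyLeq S m i k → Σ ℕ λ d → d ∈S S × ap i + d ≡ ap k
  ≼-elim i k (a , b , a-ap , b-ap , a≤b , b∸a∈S) with ap-unique i a a-ap | ap-unique k b b-ap
  ... | refl | refl = ap k ∸ ap i , b∸a∈S , m+[n∸m]≡n a≤b

  kunz-inequality : ∀ i k → InRange m i → InRange m k → AperyLeq S m i k →
                    kunz i + kunz (wilfJ m i k) + bit (k <ᵇ i) ≤ kunz k
  kunz-inequality i k (_ , i<m) (_ , k<m) i≼k with ≼-elim i k i≼k
  ... | d , d∈S , ap-sum = begin
    kunz i + kunz j + b      ≤⟨ +-monoˡ-≤ b (+-monoʳ-≤ (kunz i) (kunz-least j qd (subst (λ r → (qd * m + r) ∈S S) rd≡j (subst (_∈S S) (div-mod d) d∈S)))) ⟩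
    kunz i + qd + b          ≡⟨ q≡ ⟩
    kunz k                   ∎
    where
    open ≤-Reasoning
    j b qd rd : ℕ
    j  = wilfJ m i k
    b  = bit (k <ᵇ i)
    qd = d / m
    rd = d % m
    -- ap i + d + j = ap k + j, rearranged by the carry i + j = b·m + k, then cancel k
    base-m : (kunz i + qd + b) * m + rd ≡ kunz k * m + j
    base-m = +-cancelʳ-≡ k _ _ (begin-equality
      (kunz i + qd + b) * m + rd + k       ≡⟨ spread (kunz i) qd b m rd k ⟩
      kunz i * m + (qd * m + rd) + (b * m + k) ≡⟨ cong₂ (λ x y → kunz i * m + x + y) (sym (div-mod d)) (sym (wilfJ-carry k (<⇒≤ i<m))) ⟩
      kunz i * m + d + (i + j)             ≡⟨ regroup (kunz i * m) d i j ⟩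
      ap i + d + j                         ≡⟨ cong (_+ j) ap-sum ⟩
      kunz k * m + k + j                   ≡⟨ +-assoc (kunz k * m) k j ⟩
      kunz k * m + (k + j)                 ≡⟨ cong (kunz k * m +_) (+-comm k j) ⟩
      kunz k * m + (j + k)                 ≡⟨ +-assoc (kunz k * m) j k ⟨
      kunz k * m + j + k                   ∎)
      where
      spread : ∀ a q b m r k → (a + q + b) * m + r + k ≡ a * m + (q * m + r) + (b * m + k)
      spread = solve-∀
      regroup : ∀ x d i j → x + d + (i + j) ≡ x + i + d + j
      regroup = solve-∀
    j<m : j < m
    j<m = wilfJ-< i<m k<m
    rd≡j : rd ≡ j
    rd≡j = proj₁ (divmod-unique (kunz i + qd + b) (kunz k) (m%n<n d m) j<m base-m)
    q≡ : kunz i + qd + b ≡ kunz k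
    q≡ = proj₂ (divmod-unique (kunz i + qd + b) (kunz k) (m%n<n d m) j<m base-m)

  kunz-below-max : ∀ f n → InRange m f → ap n ≤ ap f → kunz n + bit (f <ᵇ n) ≤ kunz f
  kunz-below-max f n (_ , f<m) = quotient-mono (kunz n) (kunz f) f<m

  ap-max⇒maximal : ∀ f → InRange m f → (∀ n → InRange m n → ap n ≤ ap f) → IsMaximalIn (AperyLeq S m) m f
  ap-max⇒maximal f f-range ap-max = f-range , λ k k-range f≼k → with-d k k-range (≼-elim f k f≼k)
    where
    with-d : ∀ k → InRange m k → Σ ℕ (λ d → d ∈S S × ap f + d ≡ ap k) → k ≡ f
    with-d k k-range (d , _ , eq) = ap-injective k f k-range f-range
      (≤-antisym (ap-max k k-range) (subst (ap f ≤_) eq (m≤m+n (ap f) d)))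

  minimal⇒generator : ∀ i → IsMinimalIn (AperyLeq S m) m i → IsMinGen S (ap i)
  minimal⇒generator i ((1≤i , i<m) , minimal) = ≤-trans 1≤i (m≤n+m i _) , ap∈S i , indecomposable
    where
    -- a summand s with nonzero residue r gives r ≼ i, so r = i and s ≥ ap i: impossible
    summand : ∀ s t → s ∈S S → t ∈S S → 0 < t → s + t ≡ ap i → s % m ≢ 0 → ⊥
    summand s t s∈S t∈S 0<t s+t≡ r≢0 = <⇒≱ s<ap (subst (λ r → ap r ≤ s) r≡i (ap-least s s∈S))
      where
      open ≡-Reasoning
      r e : ℕ
      r = s % m
      e = s / m ∸ kunz r
      r≼i : AperyLeq S m r i
      r≼i = ≼-intro r i (e * m + t) (closed S _ t (multiple∈S e) t∈S) (begin
        ap r + (e * m + t) ≡⟨ +-assoc (ap r) (e * m) t ⟨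
        ap r + e * m + t   ≡⟨ cong (_+ t) (ap-decompose s s∈S) ⟨
        s + t              ≡⟨ s+t≡ ⟩
        ap i               ∎)
      r≡i : r ≡ i
      r≡i = minimal r (n≢0⇒n>0 r≢0 , m%n<n s m) r≼i
      s<ap : s < ap i
      s<ap = subst (s <_) s+t≡ (m<m+n s 0<t)
    -- if both summands were multiples of m, so would be ap i, whose residue is i ≠ 0
    indecomposable : ¬ (∃[ a ] ∃[ b ] (0 < a × 0 < b × a ∈S S × b ∈S S × a + b ≡ ap i))
    indecomposable (a , b , 0<a , 0<b , a∈S , b∈S , a+b≡) with a % m ≟ 0 | b % m ≟ 0
    ... | no a≢0  | _       = summand a b a∈S b∈S 0<b a+b≡ a≢0
    ... | yes _   | no b≢0  = summand b a b∈S a∈S 0<a (trans (+-comm b a) a+b≡) b≢0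
    ... | yes a≡0 | yes b≡0 = <⇒≱ 1≤i (≤-reflexive (begin
      i                       ≡⟨ ap-residue i i<m ⟨
      ap i % m                ≡⟨ cong (_% m) a+b≡ ⟨
      (a + b) % m             ≡⟨ %-distribˡ-+ a b m ⟩
      (a % m + b % m) % m     ≡⟨ cong₂ (λ x y → (x + y) % m) a≡0 b≡0 ⟩
      (0 * m) % m             ≡⟨ m*n%n≡0 0 m ⟩
      0                       ∎))
      where open ≡-Reasoning

  m-generator : IsMinGen S m
  m-generator = 0<m , m∈S , λ { (a , b , 0<a , 0<b , a∈S , b∈S , a+b≡m) →
    <⇒≱ (m<m+n m 0<m) (subst (m + m ≤_) a+b≡m (+-mono-≤ (below a 0<a a∈S) (below b 0<b b∈S))) }
    where
    0<m : 0 < m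
    0<m = proj₁ mult
    below : ∀ s → 0 < s → s ∈S S → m ≤ s
    below = proj₂ (proj₂ mult)

  -- e(S) ≥ 1 + #(minimal elements): m and the Apéry elements of minimal elements are
  -- pairwise distinct minimal generators (their residues are 0 and the distinct indices).
  embedding-bound : ∀ (L : List ℕ) → Unique L → (∀ {i} → i ∈ L → IsMinimalIn (AperyLeq S m) m i) →
                    ∀ e → HasCard (IsMinGen S) e → suc (length L) ≤ e
  embedding-bound L L-unique L-minimal e (G , _ , G-spec , G-length) =
    subst₂ _≤_ (cong suc (length-map ap L)) G-length (unique-⊆-length (m ∷ map ap L) G unique sub)
    where
    inRange : ∀ {i} → i ∈ L → InRange m i
    inRange = proj₁ ∘ L-minimal
    residues : map (_% m) (map ap L) ≡ L
    residues = trans (sym (map-∘ L)) (map-id-local (All.tabulate λ i∈L → ap-residue _ (proj₂ (inRange i∈L))))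
    m≢ap : ∀ {z} → z ∈ map ap L → m ≢ z
    m≢ap z∈ m≡z with ∈-map⁻ ap z∈
    ... | i , i∈L , refl = <⇒≱ (proj₁ (inRange i∈L))
      (≤-reflexive (trans (sym (ap-residue i (proj₂ (inRange i∈L)))) (trans (cong (_% m) (sym m≡z)) (n%n≡0 m))))
    unique : Unique (m ∷ map ap L)
    unique = All.tabulate m≢ap ∷ Unique.map⁻ (subst Unique (sym residues) L-unique)
    sub : ∀ {z} → z ∈ m ∷ map ap L → z ∈ G
    sub (here refl) = proj₂ (G-spec m) m-generator
    sub (there z∈) with ∈-map⁻ ap z∈
    ... | i , i∈L , refl = proj₂ (G-spec (ap i)) (minimal⇒generator i (L-minimal i∈L))

  gaps : ℕ → List ℕ
  gaps zero    = []
  gaps (suc r) = map (λ q → q * m + suc r) (upTo (kunz (suc r))) ++ gaps r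

  gaps-length : ∀ R → length (gaps R) ≡ sumTo R kunz
  gaps-length zero    = refl
  gaps-length (suc R) = trans (length-++ (map (λ q → q * m + suc R) (upTo (kunz (suc R)))))
    (cong₂ _+_ (trans (length-map _ (upTo (kunz (suc R)))) (length-upTo _)) (gaps-length R))

  gaps-complete : ∀ R r q → 1 ≤ r → r ≤ R → q < kunz r → q * m + r ∈ gaps R
  gaps-complete zero    r q 1≤r r≤0 _ = contradiction r≤0 (<⇒≱ 1≤r)
  gaps-complete (suc R) r q 1≤r r≤R q< with m≤n⇒m<n∨m≡n r≤R
  ... | inj₂ refl        = ∈-++⁺ˡ (∈-map⁺ (λ q → q * m + r) (∈-upTo⁺ q<))
  ... | inj₁ (s≤s r≤R') = ∈-++⁺ʳ _ (gaps-complete R r q 1≤r r≤R' q<)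

  gap∈gaps : ∀ x → mem S x ≡ false → x ∈ gaps (m ∸ 1)
  gap∈gaps x x∉S with x % m ≟ 0 | kunz (x % m) ≤? x / m
  ... | yes r≡0 | _ = contradiction (trans (sym x∉S) (subst (_∈S S) (sym multiple) (multiple∈S (x / m)))) λ ()
    where
    multiple : x ≡ x / m * m
    multiple = trans (div-mod x) (trans (cong (x / m * m +_) r≡0) (+-identityʳ _))
  ... | no r≢0 | yes k≤q = contradiction (trans (sym x∉S) (subst (_∈S S) (sym (div-mod x)) (above-ap∈S (x % m) (x / m) k≤q))) λ ()
  ... | no r≢0 | no k≰q = subst (_∈ gaps (m ∸ 1)) (sym (div-mod x))
    (gaps-complete (m ∸ 1) (x % m) (x / m) (n≢0⇒n>0 r≢0) r≤ (≰⇒> k≰q))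
    where
    r≤ : x % m ≤ m ∸ 1
    r≤ = s≤s⁻¹ (subst (x % m <_) (sym (suc-pred m)) (m%n<n x m))

  -- Every number below c is a small element of S or a gap, so c ≤ n(S) + Σ kunz.
  conductor≤small+gaps : ∀ c n → HasCard (SmallElt S c) n → c ≤ n + sumTo (m ∸ 1) kunz
  conductor≤small+gaps c n (small , _ , small-spec , small-length) =
    subst₂ _≤_ (length-upTo c) (trans (length-++ small) (cong₂ _+_ small-length (gaps-length (m ∸ 1))))
      (unique-⊆-length (upTo c) (small ++ gaps (m ∸ 1)) (Unique.upTo⁺ c) covered)
    where
    covered : ∀ {x} → x ∈ upTo c → x ∈ small ++ gaps (m ∸ 1)
    covered {x} x<c with mem S x in x∈?
    ... | true  = ∈-++⁺ˡ (proj₂ (small-spec x) (x∈? , ∈-upTo⁻ x<c))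
    ... | false = ∈-++⁺ʳ small (gap∈gaps x x∈?)

  -- The Frobenius number ap f − m of the largest Apéry element is a gap, so ap f < c + m.
  conductor-bound : ∀ c f → IsConductor S c → InRange m f → ap f < c + m
  conductor-bound c f (c+ℕ⊆S , _) f-range = ≰⇒> frobenius∉S
    where
    q : ℕ
    q = kunz f ∸ 1
    kunz≡ : kunz f ≡ suc q
    kunz≡ = sym (m+[n∸m]≡n (kunz-positive f f-range))
    frobenius∉S : ¬ (c + m ≤ ap f)
    frobenius∉S c+m≤ = <⇒≱ (subst (q <_) (sym kunz≡) ≤-refl) (kunz-least f q frobenius∈S)
      where
      ap≡ : ap f ≡ m + (q * m + f)
      ap≡ = trans (cong (λ k → k * m + f) kunz≡) (+-assoc m (q * m) f)
      c≤ : c ≤ q * m + f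
      c≤ = +-cancelˡ-≤ m c _ (subst₂ _≤_ (+-comm c m) ap≡ c+m≤)
      frobenius∈S : (q * m + f) ∈S S
      frobenius∈S = subst (_∈S S) (m+[n∸m]≡n c≤) (c+ℕ⊆S _)

  in-range : ∀ {n} → 1 ≤ n → n ≤ m ∸ 1 → InRange m n
  in-range 1≤n n≤ = 1≤n , subst (_ <_) (suc-pred m) (s≤s n≤)

  module LargestApery (f : ℕ) (f-range : InRange m f) (ap-max : ∀ n → InRange m n → ap n ≤ ap f) where

    above : ℕ → ℕ
    above n = bit (f <ᵇ n)

    φ : ℕ → ℕ
    φ n = kunz f ∸ (kunz n + above n)

    -- x_n + [f < n] ≤ x_f, so the subtraction in φ_n loses nothing
    weight-bound : ∀ n → InRange m n → kunz n + above n ≤ kunz f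
    weight-bound n n-range = kunz-below-max f n f-range (ap-max n n-range)

    weight-sum : sumTo (m ∸ 1) φ + (sumTo (m ∸ 1) kunz + (m ∸ 1 ∸ f)) ≡ (m ∸ 1) * kunz f
    weight-sum = begin
      sumTo M φ + (sumTo M kunz + (M ∸ f))         ≡⟨ cong (λ x → sumTo M φ + (sumTo M kunz + x)) (count-above f M) ⟨
      sumTo M φ + (sumTo M kunz + sumTo M above)   ≡⟨ cong (sumTo M φ +_) (sumTo-+ M kunz above) ⟨
      sumTo M φ + sumTo M (λ n → kunz n + above n) ≡⟨ sumTo-+ M φ (λ n → kunz n + above n) ⟨
      sumTo M (λ n → φ n + (kunz n + above n))     ≡⟨ sumTo-cong M (λ n 1≤n n≤M → m∸n+n≡m (weight-bound n (in-range 1≤n n≤M))) ⟩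
      sumTo M (λ _ → kunz f)                       ≡⟨ sumTo-const M (kunz f) ⟩
      M * kunz f                                   ∎
      where
      open ≡-Reasoning
      M = m ∸ 1

    f≤top : f ≤ m ∸ 1
    f≤top = s≤s⁻¹ (subst (f <_) (sym (suc-pred m)) (proj₂ f-range))

    -- If x_f = 1 then f = m − 1: otherwise x_{m-1} + [f < m − 1] ≥ 2 would exceed x_f.
    top-case : kunz f ≤ 1 → f ≡ m ∸ 1
    top-case x_f≤1 with m≤n⇒m<n∨m≡n f≤top
    ... | inj₂ f≡top = f≡top
    ... | inj₁ f<top = contradiction (≤-trans two≤ x_f≤1) (<⇒≱ ≤-refl)
      where
      top-range : InRange m (m ∸ 1)
      top-range = in-range (≤-trans (proj₁ f-range) (<⇒≤ f<top)) ≤-refl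
      two≤ : 2 ≤ kunz f
      two≤ = begin
        1 + 1                        ≤⟨ +-monoˡ-≤ 1 (kunz-positive (m ∸ 1) top-range) ⟩
        kunz (m ∸ 1) + 1             ≡⟨ cong (λ b → kunz (m ∸ 1) + bit b) (true-if (<⇒<ᵇ f<top)) ⟨
        kunz (m ∸ 1) + above (m ∸ 1) ≤⟨ weight-bound (m ∸ 1) top-range ⟩
        kunz f                       ∎
        where open ≤-Reasoning

module Moves where
  open import Data.Nat
  open import Data.Nat.Properties
  open import Data.Nat.Tactic.RingSolver using (solve-∀)
  open NaturalFacts

  value : ℕ → (ℕ → ℕ) → Expr → ℕ
  value R w a = sumTo R (λ n → a n * w n)

  removeOne-here : ∀ a i → removeOne a i i ≡ a i ∸ 1
  removeOne-here a i rewrite true-if (≡⇒≡ᵇ i i refl) = refl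

  removeOne-there : ∀ a i n → n ≢ i → removeOne a i n ≡ a n
  removeOne-there a i n n≢i rewrite false-if (n≢i ∘′ ≡ᵇ⇒≡ n i) = refl

  addOne-here : ∀ a k → addOne a k k ≡ suc (a k)
  addOne-here a k rewrite true-if (≡⇒≡ᵇ k k refl) = refl

  addOne-there : ∀ a k n → n ≢ k → addOne a k n ≡ a n
  addOne-there a k n n≢k rewrite false-if (n≢k ∘′ ≡ᵇ⇒≡ n k) = refl

  value-removeOne : ∀ R w a i → 1 ≤ i → i ≤ R → 1 ≤ a i → value R w (removeOne a i) + w i ≡ value R w a
  value-removeOne R w a i 1≤i i≤R 1≤ai = +-cancelʳ-≡ ((a i ∸ 1) * w i) _ _ (begin
    value R w (removeOne a i) + w i + (a i ∸ 1) * w i ≡⟨ +-assoc (value R w (removeOne a i)) (w i) _ ⟩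
    value R w (removeOne a i) + (w i + (a i ∸ 1) * w i) ≡⟨ cong (λ x → value R w (removeOne a i) + x * w i) ai≡ ⟩
    value R w (removeOne a i) + a i * w i ≡⟨ sumTo-update R i 1≤i i≤R (λ n n≢i → cong (_* w n) (removeOne-there a i n n≢i)) ⟩
    value R w a + removeOne a i i * w i ≡⟨ cong (λ x → value R w a + x * w i) (removeOne-here a i) ⟩
    value R w a + (a i ∸ 1) * w i ∎)
    where
    open ≡-Reasoning
    ai≡ : suc (a i ∸ 1) ≡ a i
    ai≡ = m+[n∸m]≡n 1≤ai

  value-addOne : ∀ R w a k → 1 ≤ k → k ≤ R → value R w (addOne a k) ≡ value R w a + w k
  value-addOne R w a k 1≤k k≤R = +-cancelʳ-≡ (a k * w k) _ _ (begin
    value R w (addOne a k) + a k * w k ≡⟨ sumTo-update R k 1≤k k≤R (λ n n≢k → cong (_* w n) (addOne-there a k n n≢k)) ⟩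
    value R w a + addOne a k k * w k   ≡⟨ cong (λ x → value R w a + x * w k) (addOne-here a k) ⟩
    value R w a + (w k + a k * w k)    ≡⟨ +-assoc (value R w a) (w k) _ ⟨
    value R w a + w k + a k * w k      ∎)
    where open ≡-Reasoning

  value-move : ∀ R w a i k → let j = wilfJ (suc R) i k in
               InRange (suc R) i → InRange (suc R) k → InRange (suc R) j →
               1 ≤ a i → 1 ≤ removeOne a i j →
               value R w (applyMove (suc R) a i k) + w i + w j ≡ value R w a + w k
  value-move R w a i k (1≤i , s≤s i≤R) (1≤k , s≤s k≤R) (1≤j , s≤s j≤R) 1≤ai 1≤aj = begin
    value R w (addOne a₂ k) + w i + w j ≡⟨ cong (λ x → x + w i + w j) (value-addOne R w a₂ k 1≤k k≤R) ⟩
    value R w a₂ + w k + w i + w j      ≡⟨ shuffle (value R w a₂) (w k) (w i) (w j) ⟩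
    value R w a₂ + w j + w i + w k      ≡⟨ cong (λ x → x + w i + w k) (value-removeOne R w a₁ j 1≤j j≤R 1≤aj) ⟩
    value R w a₁ + w i + w k            ≡⟨ cong (_+ w k) (value-removeOne R w a i 1≤i i≤R 1≤ai) ⟩
    value R w a + w k                   ∎
    where
    open ≡-Reasoning
    j : ℕ
    j = wilfJ (suc R) i k
    a₁ a₂ : Expr
    a₁ = removeOne a i
    a₂ = removeOne a₁ j
    shuffle : ∀ v x y z → v + x + y + z ≡ v + z + y + x
    shuffle = solve-∀

  value-start : ∀ R w e → value R w (startExpr (suc R) e) ≡ e * sumTo R w
  value-start R w e = trans (sumTo-cong R λ n 1≤n n≤R → cong (_* w n) (start≡ n 1≤n n≤R)) (sumTo-* R e w)
    where
    start≡ : ∀ n → 1 ≤ n → n ≤ R → startExpr (suc R) e n ≡ e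
    start≡ n 1≤n n≤R rewrite true-if (≤⇒≤ᵇ 1≤n) | true-if (<⇒<ᵇ (s≤s n≤R)) = refl

  -- Number of moves carrying the bonus (iii) — those numbered K or later — when numbering starts at t.
  late : ℕ → ℕ → List (ℕ × ℕ) → ℕ
  late K t []       = 0
  late K t (_ ∷ ms) = bit (K ≤ᵇ t) + late K (suc t) ms

  late-count : ∀ K t ms → late K t ms + (t ∸ K) ≡ (t + length ms) ∸ K
  late-count K t [] = cong (_∸ K) (sym (+-identityʳ t))
  late-count K t (_ ∷ ms) = begin
    bit (K ≤ᵇ t) + late K (suc t) ms + (t ∸ K)   ≡⟨ cong (_+ (t ∸ K)) (+-comm (bit (K ≤ᵇ t)) _) ⟩
    late K (suc t) ms + bit (K ≤ᵇ t) + (t ∸ K)   ≡⟨ +-assoc (late K (suc t) ms) _ _ ⟩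
    late K (suc t) ms + (bit (K ≤ᵇ t) + (t ∸ K)) ≡⟨ cong (late K (suc t) ms +_) step ⟩
    late K (suc t) ms + (suc t ∸ K)              ≡⟨ late-count K (suc t) ms ⟩
    (suc t + length ms) ∸ K                      ≡⟨ cong (_∸ K) (+-suc t (length ms)) ⟨
    (t + suc (length ms)) ∸ K                    ∎
    where
    open ≡-Reasoning
    step : bit (K ≤ᵇ t) + (t ∸ K) ≡ suc t ∸ K
    step with K ≤? t
    ... | yes K≤t rewrite true-if (≤⇒≤ᵇ K≤t) = sym (+-∸-assoc 1 K≤t)
    ... | no K≰t rewrite false-if (K≰t ∘′ ≤ᵇ⇒≤ K t) =
      trans (m≤n⇒m∸n≡0 (<⇒≤ (≰⇒> K≰t))) (sym (m≤n⇒m∸n≡0 (≰⇒> K≰t)))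

  late-bound : ∀ m e ms → m ∸ e ≤ length ms → late (m ∸ e) 0 ms + m ≤ length ms + e
  late-bound m e ms long = begin
    late K 0 ms + m         ≡⟨ cong (_+ m) B≡ ⟩
    (length ms ∸ K) + m     ≤⟨ +-monoʳ-≤ (length ms ∸ K) (subst (m ≤_) (+-comm e K) (m≤n+m∸n m e)) ⟩
    (length ms ∸ K) + (K + e) ≡⟨ +-assoc (length ms ∸ K) K e ⟨
    (length ms ∸ K) + K + e ≡⟨ cong (_+ e) (m∸n+n≡m long) ⟩
    length ms + e           ∎
    where
    open ≤-Reasoning
    K : ℕ
    K = m ∸ e
    B≡ : late K 0 ms ≡ length ms ∸ K
    B≡ = trans (sym (+-identityʳ _)) (trans (cong (late K 0 ms +_) (sym (0∸n≡0 K))) (late-count K 0 ms))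

  Play-map : ∀ {P P' : ℕ → ℕ → Set} {m a ms} →
             (∀ {i k} → InRange m i → InRange m k → P i k → P' i k) → Play P m a ms → Play P' m a ms
  Play-map P⊆P' done = done
  Play-map P⊆P' (move ri rk Pik i≢k ai aj play) = move ri rk (P⊆P' ri rk Pik) i≢k ai aj (Play-map P⊆P' play)

module IntegerFacts where
  open import Data.Integer hiding (_≤ᵇ_)
  open import Data.Integer.Properties
  open import Data.Integer.Tactic.RingSolver using (solve-∀)
  open import Data.Nat using (z≤n)

  ≤-by-difference : ∀ {x y} d → 0ℤ ≤ d → y - x ≡ d → x ≤ y
  ≤-by-difference d 0≤d eq = 0≤i-j⇒j≤i (subst (0ℤ ≤_) (sym eq) 0≤d)

  nonneg-+ : ∀ {x y} → 0ℤ ≤ x → 0ℤ ≤ y → 0ℤ ≤ x + y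
  nonneg-+ = +-mono-≤

  nonneg-* : ∀ {x y} → 0ℤ ≤ x → 0ℤ ≤ y → 0ℤ ≤ x * y
  nonneg-* {+ p} {+ q} _ _ = subst (0ℤ ≤_) (pos-* p q) (+≤+ z≤n)

  nonneg-diff : ∀ {x y} → x ≤ y → 0ℤ ≤ y - x
  nonneg-diff = i≤j⇒0≤j-i

  +-∸ : ∀ {a b} → b ℕ.≤ a → + (a ℕ.∸ b) ≡ + a - + b
  +-∸ {a} {b} b≤a = trans (sym (⊖-≥ b≤a)) (sym (m-n≡m⊖n a b))

  ≤-move-right : ∀ {x y z} → x ≤ y + z → x - z ≤ y
  ≤-move-right {x} {y} {z} le = ≤-by-difference _ (nonneg-diff le) (shift x y z)
    where
    shift : ∀ x y z → y - (x - z) ≡ y + z - x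
    shift = solve-∀

module Scores where
  open import Data.Nat as ℕ using (z≤n; _<ᵇ_; _≤ᵇ_)
  import Data.Nat.Properties as ℕ
  open import Data.Integer hiding (_≤ᵇ_)
  open import Data.Integer.Tactic.RingSolver using (solve-∀)
  open NaturalFacts
  open Moves
  open IntegerFacts

  -- score parts (i) and (ii) of the move x_i + x_j → x_k (all but the bonus (iii))
  baseScore : ℕ → ℕ → ℕ → ℕ → ℤ
  baseScore m f i k =
    ind (f <ᵇ i) -[1+ 0 ] + ind (f <ᵇ wilfJ m i k) -[1+ 0 ] + ind (f <ᵇ k) (+ 1) + ind (k <ᵇ i) (+ 1)

  baseSum : ℕ → ℕ → List (ℕ × ℕ) → ℤ
  baseSum m f []             = 0ℤ
  baseSum m f ((i , k) ∷ ms) = baseScore m f i k + baseSum m f ms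

  ind-+1 : ∀ c → ind c (+ 1) ≡ + bit c
  ind-+1 true  = refl
  ind-+1 false = refl

  ind--1 : ∀ c → ind c -[1+ 0 ] ≡ - + bit c
  ind--1 true  = refl
  ind--1 false = refl

  ind-+2 : ∀ c → ind c (+ 2) ≡ + (2 ℕ.* bit c)
  ind-+2 true  = refl
  ind-+2 false = refl

  baseScore-bits : ∀ m f i k → baseScore m f i k ≡
    - + bit (f <ᵇ i) + - + bit (f <ᵇ wilfJ m i k) + + bit (f <ᵇ k) + + bit (k <ᵇ i)
  baseScore-bits m f i k rewrite ind--1 (f <ᵇ i) | ind--1 (f <ᵇ wilfJ m i k) | ind-+1 (f <ᵇ k) | ind-+1 (k <ᵇ i) = refl

  score-split : ∀ m e f t ms → scoreFrom m e f t ms ≡ baseSum m f ms + + (2 ℕ.* late (m ℕ.∸ e) t ms)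
  score-split m e f t [] = refl
  score-split m e f t ((i , k) ∷ ms) = begin
    baseScore m f i k + ind (K ≤ᵇ t) (+ 2) + scoreFrom m e f (ℕ.suc t) ms
      ≡⟨ cong₂ (λ x y → baseScore m f i k + x + y) (ind-+2 (K ≤ᵇ t)) (score-split m e f (ℕ.suc t) ms) ⟩
    baseScore m f i k + + (2 ℕ.* bit (K ≤ᵇ t)) + (baseSum m f ms + + (2 ℕ.* late K (ℕ.suc t) ms))
      ≡⟨ interchange (baseScore m f i k) _ _ _ ⟩
    baseSum m f ((i , k) ∷ ms) + (+ (2 ℕ.* bit (K ≤ᵇ t)) + + (2 ℕ.* late K (ℕ.suc t) ms))
      ≡⟨ cong (λ x → baseSum m f ((i , k) ∷ ms) + + x) (ℕ.*-distribˡ-+ 2 (bit (K ≤ᵇ t)) _) ⟨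
    baseSum m f ((i , k) ∷ ms) + + (2 ℕ.* late K t ((i , k) ∷ ms)) ∎
    where
    open ≡-Reasoning
    K : ℕ
    K = m ℕ.∸ e
    interchange : ∀ a b c d → a + b + (c + d) ≡ (a + c) + (b + d)
    interchange = solve-∀

  -- One step of the potential argument: if a move lowers the potential V by x + y − z
  -- and z + Q + b ≤ x + y, then the move adds Q + b to the guaranteed bound.
  potential-step : ∀ {L Q s b V V' x y z} → V' + x + y ≡ V + z → L * Q + s ≤ V' → z + Q + b ≤ x + y →
                   (1ℤ + L) * Q + (b + s) ≤ V
  potential-step {L} {Q} {s} {b} {V} {V'} {x} {y} {z} moved bound gain =
    ≤-by-difference _ (nonneg-+ (nonneg-diff bound) (nonneg-diff gain)) (begin
      V - ((1ℤ + L) * Q + (b + s))               ≡⟨ cong (λ v → v - ((1ℤ + L) * Q + (b + s))) V≡ ⟩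
      V' + x + y - z - ((1ℤ + L) * Q + (b + s)) ≡⟨ regroup V' x y z L Q s b ⟩
      (V' - (L * Q + s)) + (x + y - (z + Q + b)) ∎)
    where
    open ≡-Reasoning
    V≡ : V ≡ V' + x + y - z
    V≡ = trans (sym (cancel V z)) (cong (_- z) (sym moved))
      where
      cancel : ∀ v z → v + z - z ≡ v
      cancel = solve-∀
    regroup : ∀ V' x y z L Q s b → V' + x + y - z - ((1ℤ + L) * Q + (b + s)) ≡ (V' - (L * Q + s)) + (x + y - (z + Q + b))
    regroup = solve-∀

  -- Potential argument: if every legal move x_i + x_j → x_k satisfies
  -- φ k + Q + (base score) ≤ φ i + φ j, then along any play the base scores and Q per
  -- move are bounded by the value of the starting expression at x = φ.
  module Potential (R : ℕ) (P : ℕ → ℕ → Set) (f : ℕ) (φ : ℕ → ℕ) (Q : ℤ)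
    (gain : ∀ i k → InRange (ℕ.suc R) i → InRange (ℕ.suc R) k → P i k → i ≢ k →
            + φ k + Q + baseScore (ℕ.suc R) f i k ≤ + φ i + + φ (wilfJ (ℕ.suc R) i k)) where

    potential-bound : ∀ {a ms} → Play P (ℕ.suc R) a ms → + length ms * Q + baseSum (ℕ.suc R) f ms ≤ + value R φ a
    potential-bound done = +≤+ z≤n
    potential-bound {a} (move {i = i} {k = k} {ms = ms} ri rk Pik i≢k 1≤ai 1≤aj play) =
      potential-step {L = + length ms} {x = + φ i} {y = + φ (wilfJ (ℕ.suc R) i k)} {z = + φ k}
        (cong +_ (value-move R φ a i k ri rk (wilfJ-range ri rk i≢k) 1≤ai 1≤aj))
        (potential-bound play) (gain i k ri rk Pik i≢k)

  -- When f = m − 1 no index exceeds f, so every move scores [k < i] ≥ 0.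
  baseSum-top : ∀ {R P a ms} → Play P (ℕ.suc R) a ms → 0ℤ ≤ baseSum (ℕ.suc R) R ms
  baseSum-top {R} done = +≤+ z≤n
  baseSum-top {R} (move {i = i} {k = k} ri rk _ i≢k _ _ play) rewrite baseScore-bits (ℕ.suc R) R i k
    | not-above ri | not-above rk | not-above (wilfJ-range ri rk i≢k) = nonneg-+ (+≤+ z≤n) (baseSum-top play)

module WilfArithmetic where
  open import Data.Integer
  open import Data.Integer.Properties
  open import Data.Integer.Tactic.RingSolver using (solve-∀)
  open import Data.Nat using (z≤n)
  open IntegerFacts

  -- With weights φ_n = Q − (x_n + h_n), the Kunz inequality x_i + x_j + b ≤ x_k
  -- makes a move gain at least Q plus its base score −h_i − h_j + h_k + b.
  move-gain-arith : ∀ {Q qi qj qk hi hj hk b φi φj φk} →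
    φi ≡ Q - (qi + hi) → φj ≡ Q - (qj + hj) → φk ≡ Q - (qk + hk) → qi + qj + b ≤ qk →
    φk + Q + (- hi + - hj + hk + b) ≤ φi + φj
  move-gain-arith {Q} {qi} {qj} {qk} {hi} {hj} {hk} {b} refl refl refl kunz-ineq =
    ≤-by-difference _ (nonneg-diff kunz-ineq) (split Q qi qj qk hi hj hk b)
    where
    split : ∀ Q qi qj qk hi hj hk b → Q - (qi + hi) + (Q - (qj + hj)) - (Q - (qk + hk) + Q + (- hi + - hj + hk + b))
          ≡ qk - (qi + qj + b)
    split = solve-∀

  -- From the potential bound at the start, a won game, and the length of the play:
  -- e·X ≤ (e − 1)·(Q·(1 + R) − H), where B counts the moves carrying the bonus.
  kunz-form-arith : ∀ (e Q X R H L B s : ℤ) →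
    L * Q + s + e * (X + H) ≤ e * (R * Q) →
    0ℤ ≤ H + (s + + 2 * B) →
    B + (1ℤ + R) ≤ L + e → 0ℤ ≤ B → 0ℤ ≤ Q →
    (+ 2 ≤ Q ⊎ (H ≡ 0ℤ × 0ℤ ≤ s)) →
    e * X ≤ (e - 1ℤ) * (Q * (1ℤ + R) - H)
  kunz-form-arith e Q X R H L B s start won long 0≤B 0≤Q cases =
    ≤-by-difference _ (nonneg-+ (nonneg-diff start) (surplus cases)) (split e Q X R H L s)
    where
    Y : ℤ
    Y = L + e - (1ℤ + R)
    0≤Y-B : 0ℤ ≤ Y - B
    0≤Y-B = subst (0ℤ ≤_) (regroup L e R B) (nonneg-diff long)
      where
      regroup : ∀ L e R B → L + e - (B + (1ℤ + R)) ≡ L + e - (1ℤ + R) - B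
      regroup = solve-∀
    0≤Y : 0ℤ ≤ Y
    0≤Y = subst (0ℤ ≤_) (restore Y B) (nonneg-+ 0≤Y-B 0≤B)
      where
      restore : ∀ Y B → Y - B + B ≡ Y
      restore = solve-∀
    -- the surplus Q·Y + H + s is non-negative: for Q ≥ 2 it absorbs the bonus 2·B,
    -- and otherwise H = 0 and s ≥ 0
    surplus : (+ 2 ≤ Q ⊎ (H ≡ 0ℤ × 0ℤ ≤ s)) → 0ℤ ≤ Q * Y + (H + s)
    surplus (inj₁ 2≤Q) = subst (0ℤ ≤_) (absorb Q Y B H s)
      (nonneg-+ (nonneg-* (nonneg-diff 2≤Q) 0≤Y) (nonneg-+ (nonneg-* {+ 2} (+≤+ z≤n) 0≤Y-B) won))
      where
      absorb : ∀ Q Y B H s → (Q - + 2) * Y + (+ 2 * (Y - B) + (H + (s + + 2 * B))) ≡ Q * Y + (H + s)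
      absorb = solve-∀
    surplus (inj₂ (H≡0 , 0≤s)) = subst (λ h → 0ℤ ≤ Q * Y + (h + s)) (sym H≡0)
      (subst (λ x → 0ℤ ≤ Q * Y + x) (sym (+-identityˡ s)) (nonneg-+ (nonneg-* 0≤Q 0≤Y) 0≤s))
    split : ∀ e Q X R H L s → (e - 1ℤ) * (Q * (1ℤ + R) - H) - e * X
          ≡ (e * (R * Q) - (L * Q + s + e * (X + H))) + (Q * (L + e - (1ℤ + R)) + (H + s))
    split = solve-∀

  wilf-from-kunz-form : ∀ (e X C c n : ℤ) → e * X ≤ (e - 1ℤ) * C → C ≤ c → c ≤ n + X → 1ℤ ≤ e → c ≤ e * n
  wilf-from-kunz-form e X C c n kunz-form C≤c c≤n+X 1≤e =
    ≤-by-difference _ (nonneg-+ (nonneg-+ (nonneg-* 0≤e (nonneg-diff c≤n+X)) (nonneg-diff kunz-form))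
                                (nonneg-* (nonneg-diff 1≤e) (nonneg-diff C≤c)))
      (split e X C c n)
    where
    0≤e : 0ℤ ≤ e
    0≤e = ≤-trans (+≤+ z≤n) 1≤e
    split : ∀ e X C c n → e * n - c ≡ e * (n + X - c) + ((e - 1ℤ) * C - e * X) + (e - 1ℤ) * (c - C)
    split = solve-∀

-- The Wilf game for an index f of largest Apéry element, played in the Apéry poset of S.
module KunzForm (R : ℕ) (S : NumericalSemigroup) (mult : IsMultiplicity S (ℕ.suc R)) (f : ℕ)
  (f-range : InRange (ℕ.suc R) f)
  (ap-max : ∀ n → InRange (ℕ.suc R) n → AperySet.ap (ℕ.suc R) S mult n ℕ.≤ AperySet.ap (ℕ.suc R) S mult f)
  where
  open import Data.Nat as ℕ using (suc; z≤n)
  import Data.Nat.Properties as ℕ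
  open import Data.Integer using (ℤ; +_; 0ℤ; 1ℤ; _+_; _-_; _*_; _≤_; +≤+)
  open import Data.Integer.Properties using (pos-*; +-monoˡ-≤; drop‿+≤+)
  open NaturalFacts
  open AperySet (suc R) S mult
  open LargestApery f f-range ap-max
  open Moves
  open Scores
  open IntegerFacts
  open WilfArithmetic

  -- x_f, the number X = Σ x_n of gaps, and the number H = m − 1 − f of indices above f
  Q X H : ℕ
  Q = kunz f
  X = sumTo R kunz
  H = R ℕ.∸ f

  f≤R : f ℕ.≤ R
  f≤R = ℕ.s≤s⁻¹ (proj₂ f-range)

  move-gain : ∀ i k → InRange (suc R) i → InRange (suc R) k → AperyLeq S (suc R) i k → i ≢ k →
              + φ k + + Q + baseScore (suc R) f i k ≤ + φ i + + φ (wilfJ (suc R) i k)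
  move-gain i k i-range k-range i≼k i≢k =
    subst (λ b → + φ k + + Q + b ≤ + φ i + + φ j) (sym (baseScore-bits (suc R) f i k))
      (move-gain-arith {Q = + Q} {qi = + kunz i} {qj = + kunz j} {qk = + kunz k}
                       {hi = + above i} {hj = + above j} {hk = + above k} {b = + bit (k ℕ.<ᵇ i)}
                       (+-∸ (weight-bound i i-range)) (+-∸ (weight-bound j j-range)) (+-∸ (weight-bound k k-range))
                       (+≤+ (kunz-inequality i k i-range k-range i≼k)))
    where
    j : ℕ
    j = wilfJ (suc R) i k
    j-range : InRange (suc R) j
    j-range = wilfJ-range i-range k-range i≢k

  open Potential R (AperyLeq S (suc R)) f φ (+ Q) move-gain

  -- A won Wilf game for f gives the theorem in Kunz coordinates: E·X ≤ (E − 1)·C with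
  -- C = x_f·m − (m − 1 − f) = ap f − m + 1.
  kunz-form : ∀ E ms → WinsWilfGame (AperyLeq S (suc R)) (suc R) E f ms →
              + E * + X ≤ (+ E - 1ℤ) * (+ Q * (1ℤ + + R) - + H)
  kunz-form E ms (play , long , won) =
    kunz-form-arith (+ E) (+ Q) (+ X) (+ R) (+ H) (+ L) (+ B) s start won′ long′ (+≤+ z≤n) (+≤+ z≤n) cases
    where
    L K B V : ℕ
    L = length ms
    K = suc R ℕ.∸ E
    B = late K 0 ms
    V = value R φ (startExpr (suc R) E)
    s : ℤ
    s = baseSum (suc R) f ms
    start-value : V ℕ.+ E ℕ.* (X ℕ.+ H) ≡ E ℕ.* (R ℕ.* Q)
    start-value = begin
      V ℕ.+ E ℕ.* (X ℕ.+ H)               ≡⟨ cong (ℕ._+ E ℕ.* (X ℕ.+ H)) (value-start R φ E) ⟩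
      E ℕ.* sumTo R φ ℕ.+ E ℕ.* (X ℕ.+ H) ≡⟨ ℕ.*-distribˡ-+ E (sumTo R φ) (X ℕ.+ H) ⟨
      E ℕ.* (sumTo R φ ℕ.+ (X ℕ.+ H))     ≡⟨ cong (E ℕ.*_) weight-sum ⟩
      E ℕ.* (R ℕ.* Q)                     ∎
      where open ≡-Reasoning
    start : + L * + Q + s + + E * (+ X + + H) ≤ + E * (+ R * + Q)
    start = subst₂ _≤_ (cong (λ z → + L * + Q + s + z) (pos-* E (X ℕ.+ H)))
                       (trans (cong +_ start-value) (trans (pos-* E (R ℕ.* Q)) (cong (λ z → + E * z) (pos-* R Q))))
                       (+-monoˡ-≤ (+ (E ℕ.* (X ℕ.+ H))) (potential-bound play))
    won′ : 0ℤ ≤ + H + (s + + 2 * + B)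
    won′ = subst₂ (λ h b → 0ℤ ≤ h + (s + b)) (sym (+-∸ f≤R)) (pos-* 2 B)
             (subst (λ x → 0ℤ ≤ (+ R - + f) + x) (score-split (suc R) E f 0 ms) won)
    long′ : + B + (1ℤ + + R) ≤ + L + + E
    long′ = +≤+ (late-bound (suc R) E ms long)
    cases : + 2 ≤ + Q ⊎ (+ H ≡ 0ℤ × 0ℤ ≤ s)
    cases with 2 ℕ.≤? Q
    ... | yes 2≤Q = inj₁ (+≤+ 2≤Q)
    ... | no 2≰Q = inj₂ (cong +_ (trans (cong (R ℕ.∸_) f≡R) (ℕ.n∸n≡0 R)) ,
                         subst (λ g → 0ℤ ≤ baseSum (suc R) g ms) (sym f≡R) (baseSum-top play))
      where
      f≡R : f ≡ R
      f≡R = top-case (ℕ.s≤s⁻¹ (ℕ.≰⇒> 2≰Q))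

  -- The Frobenius number ap f − m is a gap: C = x_f·m − (m − 1 − f) ≤ c.
  frobenius-bound : ∀ c → IsConductor S c → + Q * (1ℤ + + R) - + H ≤ + c
  frobenius-bound c conductor = ≤-move-right (subst (_≤ + c + + H) (pos-* Q (suc R)) (+≤+ Qm≤c+H))
    where
    open ℕ.≤-Reasoning
    Qm≤c+H : Q ℕ.* suc R ℕ.≤ c ℕ.+ H
    Qm≤c+H = ℕ.+-cancelʳ-≤ f _ _ (begin
      Q ℕ.* suc R ℕ.+ f   ≤⟨ ℕ.s≤s⁻¹ (subst (ap f ℕ.<_) (ℕ.+-suc c R) (conductor-bound c f conductor f-range)) ⟩
      c ℕ.+ R             ≡⟨ cong (c ℕ.+_) (ℕ.m+[n∸m]≡n f≤R) ⟨
      c ℕ.+ (f ℕ.+ H)     ≡⟨ cong (c ℕ.+_) (ℕ.+-comm f H) ⟩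
      c ℕ.+ (H ℕ.+ f)     ≡⟨ ℕ.+-assoc c H f ⟨
      c ℕ.+ H ℕ.+ f       ∎)

  wilf-inequality : ∀ c n E ms → IsConductor S c → HasCard (SmallElt S c) n → 1 ℕ.≤ E →
                    WinsWilfGame (AperyLeq S (suc R)) (suc R) E f ms → c ℕ.≤ E ℕ.* n
  wilf-inequality c n E ms conductor small 1≤E win = drop‿+≤+ (subst (+ c ≤_) (sym (pos-* E n))
    (wilf-from-kunz-form (+ E) (+ X) _ (+ c) (+ n) (kunz-form E ms win) (frobenius-bound c conductor)
                         (+≤+ (conductor≤small+gaps c n small)) (+≤+ 1≤E)))

-- Being maximal or minimal, and winning the Wilf game, only depend on the Apéry poset.
module SamePoset (S T : NumericalSemigroup) (m : ℕ) (same : SameAperyPoset S T m) where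
  open Moves using (Play-map)

  maximal-transfer : ∀ {f} → IsMaximalIn (AperyLeq S m) m f → IsMaximalIn (AperyLeq T m) m f
  maximal-transfer (f-range , maximal) =
    f-range , λ k k-range f≼k → maximal k k-range (proj₂ (same _ k f-range k-range) f≼k)

  minimal-transfer : ∀ {i} → IsMinimalIn (AperyLeq T m) m i → IsMinimalIn (AperyLeq S m) m i
  minimal-transfer (i-range , minimal) =
    i-range , λ j j-range j≼i → minimal j j-range (proj₁ (same j _ j-range i-range) j≼i)

  win-transfer : ∀ {e f ms} → WinsWilfGame (AperyLeq T m) m e f ms → WinsWilfGame (AperyLeq S m) m e f ms
  win-transfer (play , long , won) = Play-map (λ i-range k-range → proj₂ (same _ _ i-range k-range)) play , long , won

open import Data.Nat using (suc; _≤_; _*_; s≤s; z≤n)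
import Data.Nat.Properties as ℕ
open NaturalFacts using (argmax)

theorem6p5 : (m : ℕ) → 3 ≤ m →
    (T : NumericalSemigroup) → IsMultiplicity T m →
    (k : ℕ) → HasCard (IsMinimalIn (AperyLeq T m) m) k →
    (∀ f → IsMaximalIn (AperyLeq T m) m f →
      ∃[ ms ] WinsWilfGame (AperyLeq T m) m (suc k) f ms) →
    (S : NumericalSemigroup) → IsMultiplicity S m → SameAperyPoset S T m →
    (c n e : ℕ) → IsConductor S c → HasCard (SmallElt S c) n →
    HasCard (IsMinGen S) e →
    c ≤ e * n
theorem6p5 m@(suc (suc (suc p))) (s≤s (s≤s (s≤s _))) T _ k (minimals , minimals-unique , minimals-spec , minimals-length) wins
           S multS same c n e conductor small generators =
  ℕ.≤-trans (wilf-inequality c n (suc k) ms conductor small (s≤s z≤n) (win-transfer {e = suc k} {f = f} {ms = ms} won))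
            (ℕ.*-monoˡ-≤ n (subst (_≤ e) (cong suc minimals-length) e-bound))
  where
  open AperySet m S multS
  open SamePoset S T m same
  -- an index f with the largest Apéry element is maximal, so the hypothesis supplies a won game
  largest : Σ ℕ λ f → InRange m f × (∀ i → InRange m i → ap i ≤ ap f)
  largest = argmax ap (suc p)
  f : ℕ
  f = proj₁ largest
  open KunzForm (suc (suc p)) S multS f (proj₁ (proj₂ largest)) (proj₂ (proj₂ largest))
  game : ∃[ ms ] WinsWilfGame (AperyLeq T m) m (suc k) f ms
  game = wins f (maximal-transfer (ap-max⇒maximal f (proj₁ (proj₂ largest)) (proj₂ (proj₂ largest))))
  ms : List (ℕ × ℕ)
  ms = proj₁ game
  won : WinsWilfGame (AperyLeq T m) m (suc k) f ms
  won = proj₂ game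
  e-bound : suc (length minimals) ≤ e
  e-bound = embedding-bound minimals minimals-unique (λ i∈ → minimal-transfer (proj₁ (minimals-spec _) i∈)) e generators
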